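{- If $r\ge 2$ and $m\ge r+1$, then \[S(r,m)=S(1,m)+\sum_{k=1}^{r-1}\frac{1}{k}\left[S(k,m-1)-B(k,m)\right].\]
   Context: $H_n=\sum_{k=1}^n\frac1k$, $H_n^{(1)}=H_n$, and $H_n^{(r)}=\sum_{k=1}^n H_k^{(r-1)}$ for $r>1$ (hyperharmonic numbers). $S(r,m):=\sum_{n=1}^\infty\frac{H_n^{(r)}}{n^m}$. $(x)_n=x(x+1)\cdots(x+n-1)$ is the Pochhammer symbol, and $B(k,m)$ is the hypergeometric value ${}_{m+1}F_m(1,1,\dots,1,k+1;\,2,2,\dots,2;\,1)$ (with $m$ upper parameters equal to $1$, one upper parameter $k+1$, and $m$ lower parameters equal to $2$), i.e. $B(k,m)=\sum_{n=0}^\infty\frac{(1)_n^m\,(k+1)_n}{(2)_n^m\,n!}=\sum_{n=0}^\infty\frac{(k+1)_n}{n!\,(n+1)^m}=\frac{1}{k!}\sum_{n=1}^\infty\frac{(n)_k}{n^m}$. -}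

module Defs where

open import Data.Nat using (ℕ; zero; suc; _^_; _!) renaming (_*_ to _*ℕ_)
open import Data.Integer using (+_)
open import Data.Rational using (ℚ; 0ℚ; _/_; _+_; _*_)

sumTo : ℕ → (ℕ → ℚ) → ℚ
sumTo zero    f = 0ℚ
sumTo (suc N) f = sumTo N f + f (suc N)

sumFrom0 : ℕ → (ℕ → ℚ) → ℚ
sumFrom0 zero    f = 0ℚ
sumFrom0 (suc N) f = sumFrom0 N f + f N

-- ratio a b = a / b  (as a rational), with the convention a / 0 = 0 (never used)
ratio : ℕ → ℕ → ℚ
ratio a zero    = 0ℚ
ratio a (suc b) = (+ a) / suc b

harm : ℕ → ℚ
harm n = sumTo n (λ k → ratio 1 k)

-- hyperharmonic numbers H_n^{(r)}, r ≥ 1 (H^{(0)} set to 0, never used)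
hyper : ℕ → ℕ → ℚ
hyper zero          n = 0ℚ
hyper (suc zero)    n = harm n
hyper (suc (suc r)) n = sumTo n (λ k → hyper (suc r) k)

poch : ℕ → ℕ → ℕ
poch x zero    = 1
poch x (suc n) = poch x n *ℕ (x Data.Nat.+ n)

-- N-th partial sum of S(r,m) = Σ_{n≥1} H_n^{(r)} / n^m
Spart : ℕ → ℕ → ℕ → ℚ
Spart r m N = sumTo N (λ n → hyper r n * ratio 1 (n ^ m))

-- N-th partial sum of B(k,m) = Σ_{n≥0} (k+1)_n / (n! (n+1)^m)
Bpart : ℕ → ℕ → ℕ → ℚ
Bpart k m N = sumFrom0 N (λ n → ratio (poch (suc k) n) ((n !) *ℕ (suc n ^ m)))

-- The identity already holds exactly for the partial sums.
-- Hyperharmonic numbers satisfy (j+1) H_{j+1}^{(k)} = k H_j^{(k+1)} + (k+1)_j / j!,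
-- by a double induction whose step is Pascal's rule. Combined with
-- H_{n+1}^{(k+1)} = H_n^{(k+1)} + H_{n+1}^{(k)} this splits the n-th term of S(k+1,m)
-- into terms of S(k,m), S(k,m-1) and B(k,m), giving
-- S(k+1,m) = S(k,m) + (S(k,m-1) - B(k,m)) / k; summing over k gives the theorem.
module Submission where

open import Defs
open import Data.Nat using (ℕ; zero; suc; pred; _!; _^_; NonZero; _≤_; _∸_)
  renaming (_+_ to _+ℕ_; _*_ to _*ℕ_)
import Data.Nat.Properties as ℕₚ
open import Data.Nat.Properties using (_!≢0; m*n≢0; m^n≢0)
open import Data.Nat.Tactic.RingSolver using (solve-∀) renaming (solve to solveℕ)
open import Data.List using ([]; _∷_)
open import Data.Integer using (+_)
import Data.Integer as ℤ
import Data.Integer.Properties as ℤ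
open import Data.Product using (∃-syntax; _,_)
open import Data.Rational using (ℚ; 0ℚ; 1ℚ; _+_; _*_; _-_; _<_; ∣_∣; toℚᵘ)
open import Data.Rational.Properties
  using (toℚᵘ-injective; toℚᵘ-homo-*; toℚᵘ-homo-+; toℚᵘ-fromℚᵘ; +-identityʳ; +-assoc; +-inverseʳ; *-zeroʳ; *-distribˡ-+)
open import Data.Rational.Solver using (module +-*-Solver)
open import Data.Rational.Unnormalised using (mkℚᵘ; *≡*)
  renaming (_≃_ to _≃ᵘ_; _*_ to _*ᵘ_; _+_ to _+ᵘ_)
open import Data.Rational.Unnormalised.Properties using (module ≃-Reasoning; *-cong; +-cong)
open import Relation.Binary.PropositionalEquality

open +-*-Solver

toℚᵘ-ratio : ∀ a b → toℚᵘ (ratio a (suc b)) ≃ᵘ mkℚᵘ (+ a) b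
toℚᵘ-ratio a b = toℚᵘ-fromℚᵘ (mkℚᵘ (+ a) b)

ratio-cong : ∀ a b c d {{_ : NonZero b}} {{_ : NonZero d}} →
             a *ℕ d ≡ c *ℕ b → ratio a b ≡ ratio c d
ratio-cong a (suc b) c (suc d) eq = toℚᵘ-injective (begin
  toℚᵘ (ratio a (suc b)) ≈⟨ toℚᵘ-ratio a b ⟩
  mkℚᵘ (+ a) b           ≈⟨ *≡* (trans (sym (ℤ.pos-* a (suc d))) (trans (cong +_ eq) (ℤ.pos-* c (suc b)))) ⟩
  mkℚᵘ (+ c) d           ≈⟨ toℚᵘ-ratio c d ⟨
  toℚᵘ (ratio c (suc d)) ∎)
  where open ≃-Reasoning

ratio-* : ∀ a b c d {{_ : NonZero b}} {{_ : NonZero d}} →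
          ratio a b * ratio c d ≡ ratio (a *ℕ c) (b *ℕ d)
ratio-* a (suc b) c (suc d) = toℚᵘ-injective (begin
  toℚᵘ (ratio a (suc b) * ratio c (suc d))               ≈⟨ toℚᵘ-homo-* (ratio a (suc b)) (ratio c (suc d)) ⟩
  toℚᵘ (ratio a (suc b)) *ᵘ toℚᵘ (ratio c (suc d))      ≈⟨ *-cong (toℚᵘ-ratio a b) (toℚᵘ-ratio c d) ⟩
  mkℚᵘ (+ a) b *ᵘ mkℚᵘ (+ c) d                            ≈⟨ *≡* (cong (ℤ._* + (suc b *ℕ suc d)) (sym (ℤ.pos-* a c))) ⟩
  mkℚᵘ (+ (a *ℕ c)) (d +ℕ b *ℕ suc d)                      ≈⟨ toℚᵘ-ratio (a *ℕ c) (d +ℕ b *ℕ suc d) ⟨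
  toℚᵘ (ratio (a *ℕ c) (suc b *ℕ suc d))                   ∎)
  where open ≃-Reasoning

ratio-+ : ∀ a b c d {{_ : NonZero b}} {{_ : NonZero d}} →
          ratio a b + ratio c d ≡ ratio (a *ℕ d +ℕ c *ℕ b) (b *ℕ d)
ratio-+ a (suc b) c (suc d) = toℚᵘ-injective (begin
  toℚᵘ (ratio a (suc b) + ratio c (suc d))               ≈⟨ toℚᵘ-homo-+ (ratio a (suc b)) (ratio c (suc d)) ⟩
  toℚᵘ (ratio a (suc b)) +ᵘ toℚᵘ (ratio c (suc d))      ≈⟨ +-cong (toℚᵘ-ratio a b) (toℚᵘ-ratio c d) ⟩
  mkℚᵘ (+ a) b +ᵘ mkℚᵘ (+ c) d                            ≈⟨ *≡* (cong (ℤ._* + (suc b *ℕ suc d)) (sym numerator)) ⟩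
  mkℚᵘ (+ (a *ℕ suc d +ℕ c *ℕ suc b)) (d +ℕ b *ℕ suc d)   ≈⟨ toℚᵘ-ratio (a *ℕ suc d +ℕ c *ℕ suc b) (d +ℕ b *ℕ suc d) ⟨
  toℚᵘ (ratio (a *ℕ suc d +ℕ c *ℕ suc b) (suc b *ℕ suc d)) ∎)
  where
  open ≃-Reasoning
  numerator : + (a *ℕ suc d +ℕ c *ℕ suc b) ≡ + a ℤ.* + suc d ℤ.+ + c ℤ.* + suc b
  numerator = trans (ℤ.pos-+ (a *ℕ suc d) (c *ℕ suc b)) (cong₂ ℤ._+_ (ℤ.pos-* a (suc d)) (ℤ.pos-* c (suc b)))

fromℕ : ℕ → ℚ
fromℕ n = ratio n 1

fromℕ-suc : ∀ n → fromℕ (suc n) ≡ fromℕ n + 1ℚ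
fromℕ-suc n = sym (trans (ratio-+ n 1 1 1) (ratio-cong (n *ℕ 1 +ℕ 1 *ℕ 1) 1 (suc n) 1 (solveℕ (n ∷ []))))

fromℕ-*-ratio-inverse : ∀ n {{_ : NonZero n}} → fromℕ n * ratio 1 n ≡ 1ℚ
fromℕ-*-ratio-inverse n = trans (ratio-* n 1 1 n)
  (ratio-cong (n *ℕ 1) (1 *ℕ n) 1 1 {{m*n≢0 1 n}} (solveℕ (n ∷ [])))

fromℕ-*-ratio-cancel : ∀ n a d {{_ : NonZero n}} {{_ : NonZero d}} →
                       fromℕ n * ratio a (n *ℕ d) ≡ ratio a d
fromℕ-*-ratio-cancel n a d = trans (ratio-* n 1 a (n *ℕ d) {{_}} {{m*n≢0 n d}})
  (ratio-cong (n *ℕ a) (1 *ℕ (n *ℕ d)) a d {{m*n≢0 1 (n *ℕ d) {{_}} {{m*n≢0 n d}}}} (solveℕ (n ∷ a ∷ d ∷ [])))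

ratio-*-reciprocal : ∀ a b d {{_ : NonZero b}} {{_ : NonZero d}} →
                     ratio a b * ratio 1 d ≡ ratio a (b *ℕ d)
ratio-*-reciprocal a b d = trans (ratio-* a b 1 d) (cong (λ x → ratio x (b *ℕ d)) (ℕₚ.*-identityʳ a))

poch-suc : ∀ x n → poch x (suc n) ≡ x *ℕ poch (suc x) n
poch-suc x zero    = trans (ℕₚ.*-identityˡ (x +ℕ 0)) (trans (ℕₚ.+-identityʳ x) (sym (ℕₚ.*-identityʳ x)))
poch-suc x (suc n) = begin
  poch x (suc n) *ℕ (x +ℕ suc n)       ≡⟨ cong₂ _*ℕ_ (poch-suc x n) (ℕₚ.+-suc x n) ⟩
  x *ℕ poch (suc x) n *ℕ (suc x +ℕ n)  ≡⟨ ℕₚ.*-assoc x _ _ ⟩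
  x *ℕ (poch (suc x) n *ℕ (suc x +ℕ n)) ∎
  where open ≡-Reasoning

poch-one : ∀ n → poch 1 n ≡ n !
poch-one zero    = refl
poch-one (suc n) = trans (cong (_*ℕ suc n) (poch-one n)) (ℕₚ.*-comm (n !) (suc n))

-- binom k j = C(k + j, j)
binom : ℕ → ℕ → ℚ
binom k j = ratio (poch (suc k) j) (j !)

binom-zeroˡ : ∀ j → binom 0 j ≡ 1ℚ
binom-zeroˡ j = ratio-cong (poch 1 j) (j !) 1 1 {{j !≢0}}
  (trans (ℕₚ.*-identityʳ _) (trans (poch-one j) (sym (ℕₚ.*-identityˡ _))))

binom-pascal : ∀ k j → binom (suc k) (suc j) ≡ binom (suc k) j + binom k (suc j)
binom-pascal k j = sym (trans (ratio-+ _ (j !) _ (suc j !) {{j !≢0}} {{suc j !≢0}})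
  (ratio-cong _ _ _ _ {{m*n≢0 (j !) (suc j !) {{j !≢0}} {{suc j !≢0}}}} {{suc j !≢0}} cross))
  where
  cross : (poch (2 +ℕ k) j *ℕ suc j ! +ℕ poch (suc k) (suc j) *ℕ j !) *ℕ suc j !
        ≡ poch (2 +ℕ k) (suc j) *ℕ (j ! *ℕ suc j !)
  cross rewrite poch-suc (suc k) j = expand (poch (2 +ℕ k) j) k j (j !)
    where
    expand : ∀ P k j J → (P *ℕ (suc j *ℕ J) +ℕ suc k *ℕ P *ℕ J) *ℕ (suc j *ℕ J)
                       ≡ P *ℕ (2 +ℕ k +ℕ j) *ℕ (J *ℕ (suc j *ℕ J))
    expand = solve-∀

-- H⁽⁰⁾ₙ := 1/n makes H⁽ᵏ⁺¹⁾ₙ₊₁ = H⁽ᵏ⁺¹⁾ₙ + H⁽ᵏ⁾ₙ₊₁ hold for k = 0 as well.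
hyper⁰ : ℕ → ℕ → ℚ
hyper⁰ zero    n = ratio 1 n
hyper⁰ (suc r) n = hyper (suc r) n

hyper-suc : ∀ k n → hyper (suc k) (suc n) ≡ hyper (suc k) n + hyper⁰ k (suc n)
hyper-suc zero    n = refl
hyper-suc (suc k) n = refl

hyper-zero : ∀ k → hyper k 0 ≡ 0ℚ
hyper-zero zero          = refl
hyper-zero (suc zero)    = refl
hyper-zero (suc (suc k)) = refl

hyper⁰-one : ∀ k → hyper⁰ k 1 ≡ 1ℚ
hyper⁰-one zero    = refl
hyper⁰-one (suc k) = begin
  hyper (suc k) 1             ≡⟨ hyper-suc k 0 ⟩
  hyper (suc k) 0 + hyper⁰ k 1 ≡⟨ cong₂ _+_ (hyper-zero (suc k)) (hyper⁰-one k) ⟩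
  0ℚ + 1ℚ                      ≡⟨⟩
  1ℚ                           ∎
  where open ≡-Reasoning

hyper-recurrence : ∀ k j → fromℕ k * hyper (suc k) j + binom k j ≡ fromℕ (suc j) * hyper⁰ k (suc j)
hyper-recurrence k zero = begin
  fromℕ k * hyper (suc k) 0 + 1ℚ ≡⟨ cong (λ h → fromℕ k * h + 1ℚ) (hyper-zero (suc k)) ⟩
  fromℕ k * 0ℚ + 1ℚ              ≡⟨ solve 1 (λ x → x :* con 0ℚ :+ con 1ℚ := con 1ℚ :* con 1ℚ) refl (fromℕ k) ⟩
  1ℚ * 1ℚ                        ≡⟨ cong (1ℚ *_) (sym (hyper⁰-one k)) ⟩
  fromℕ 1 * hyper⁰ k 1           ∎
  where open ≡-Reasoning
hyper-recurrence zero (suc j) = begin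
  0ℚ * hyper 1 (suc j) + binom 0 (suc j) ≡⟨ cong (_+_ (0ℚ * hyper 1 (suc j))) (binom-zeroˡ (suc j)) ⟩
  0ℚ * hyper 1 (suc j) + 1ℚ              ≡⟨ solve 1 (λ h → con 0ℚ :* h :+ con 1ℚ := con 1ℚ) refl (hyper 1 (suc j)) ⟩
  1ℚ                                     ≡⟨ fromℕ-*-ratio-inverse (2 +ℕ j) ⟨
  fromℕ (2 +ℕ j) * ratio 1 (2 +ℕ j)      ∎
  where open ≡-Reasoning
hyper-recurrence (suc k) (suc j) = begin
  k₁ * (H + h) + binom (suc k) (suc j)
    ≡⟨ cong (_+_ (k₁ * (H + h))) (binom-pascal k j) ⟩
  k₁ * (H + h) + (b + b′)
    ≡⟨ cong (λ x → x * (H + h) + (b + b′)) (fromℕ-suc k) ⟩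
  (k₀ + 1ℚ) * (H + h) + (b + b′)
    ≡⟨ solve 5 (λ k₀ H h b b′ → (k₀ :+ con 1ℚ) :* (H :+ h) :+ (b :+ b′)
                := ((k₀ :+ con 1ℚ) :* H :+ b) :+ (k₀ :* h :+ b′) :+ h) refl k₀ H h b b′ ⟩
  ((k₀ + 1ℚ) * H + b) + (k₀ * h + b′) + h
    ≡⟨ cong (λ x → (x * H + b) + (k₀ * h + b′) + h) (fromℕ-suc k) ⟨
  (k₁ * H + b) + (k₀ * h + b′) + h
    ≡⟨ cong₂ (λ x y → x + y + h) (hyper-recurrence (suc k) j) (hyper-recurrence k (suc j)) ⟩
  j₁ * h + j₂ * g + h
    ≡⟨ cong (λ x → j₁ * h + x * g + h) (fromℕ-suc (suc j)) ⟩
  j₁ * h + (j₁ + 1ℚ) * g + h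
    ≡⟨ solve 3 (λ j₁ h g → j₁ :* h :+ (j₁ :+ con 1ℚ) :* g :+ h := (j₁ :+ con 1ℚ) :* (h :+ g)) refl j₁ h g ⟩
  (j₁ + 1ℚ) * (h + g)
    ≡⟨ cong (_* (h + g)) (fromℕ-suc (suc j)) ⟨
  j₂ * (h + g)
    ≡⟨ cong (j₂ *_) (hyper-suc k (suc j)) ⟨
  j₂ * hyper (suc k) (2 +ℕ j) ∎
  where
  open ≡-Reasoning
  k₀ k₁ j₁ j₂ H h g b b′ : ℚ
  k₀ = fromℕ k
  k₁ = fromℕ (suc k)
  j₁ = fromℕ (suc j)
  j₂ = fromℕ (2 +ℕ j)
  H = hyper (2 +ℕ k) j
  h = hyper (suc k) (suc j)
  g = hyper⁰ k (2 +ℕ j)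
  b = binom (suc k) j
  b′ = binom k (suc j)

sumTo-cong : ∀ N {f g : ℕ → ℚ} → (∀ n → f (suc n) ≡ g (suc n)) → sumTo N f ≡ sumTo N g
sumTo-cong zero    eq = refl
sumTo-cong (suc N) eq = cong₂ _+_ (sumTo-cong N eq) (eq N)

sumTo-+ : ∀ N (f g : ℕ → ℚ) → sumTo N (λ n → f n + g n) ≡ sumTo N f + sumTo N g
sumTo-+ zero    f g = refl
sumTo-+ (suc N) f g = trans (cong (_+ (f (suc N) + g (suc N))) (sumTo-+ N f g))
  (solve 4 (λ a b c d → (a :+ b) :+ (c :+ d) := (a :+ c) :+ (b :+ d)) refl
    (sumTo N f) (sumTo N g) (f (suc N)) (g (suc N)))

sumTo-- : ∀ N (f g : ℕ → ℚ) → sumTo N (λ n → f n - g n) ≡ sumTo N f - sumTo N g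
sumTo-- zero    f g = refl
sumTo-- (suc N) f g = trans (cong (_+ (f (suc N) - g (suc N))) (sumTo-- N f g))
  (solve 4 (λ a b c d → (a :- b) :+ (c :- d) := (a :+ c) :- (b :+ d)) refl
    (sumTo N f) (sumTo N g) (f (suc N)) (g (suc N)))

sumTo-*ˡ : ∀ N c (f : ℕ → ℚ) → sumTo N (λ n → c * f n) ≡ c * sumTo N f
sumTo-*ˡ zero    c f = sym (*-zeroʳ c)
sumTo-*ˡ (suc N) c f = trans (cong (_+ c * f (suc N)) (sumTo-*ˡ N c f))
  (sym (*-distribˡ-+ c (sumTo N f) (f (suc N))))

sumFrom0-sumTo : ∀ N (f : ℕ → ℚ) → sumFrom0 N f ≡ sumTo N (λ n → f (pred n))
sumFrom0-sumTo zero    f = refl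
sumFrom0-sumTo (suc N) f = cong (_+ f N) (sumFrom0-sumTo N f)

hyper-summand-split : ∀ k m n →
  hyper (2 +ℕ k) (suc n) * ratio 1 (suc n ^ suc m)
  ≡ hyper (suc k) (suc n) * ratio 1 (suc n ^ suc m)
    + ratio 1 (suc k) * (hyper (suc k) (suc n) * ratio 1 (suc n ^ m)
                         - ratio (poch (2 +ℕ k) n) (n ! *ℕ suc n ^ suc m))
hyper-summand-split k m n = begin
  (A + h) * u
    ≡⟨ solve 3 (λ A h u → (A :+ h) :* u := h :* u :+ con 1ℚ :* (A :* u)) refl A h u ⟩
  h * u + 1ℚ * (A * u)
    ≡⟨ cong (λ x → h * u + x * (A * u)) (fromℕ-*-ratio-inverse (suc k)) ⟨
  h * u + (κ * i) * (A * u)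
    ≡⟨ solve 6 (λ κ i A h u b → h :* u :+ (κ :* i) :* (A :* u)
                := h :* u :+ i :* ((κ :* A :+ b) :* u :- b :* u)) refl κ i A h u b ⟩
  h * u + i * ((κ * A + b) * u - b * u)
    ≡⟨ cong (λ x → h * u + i * (x * u - b * u)) (hyper-recurrence (suc k) n) ⟩
  h * u + i * ((ν * h) * u - b * u)
    ≡⟨ solve 5 (λ ν i h u c → h :* u :+ i :* ((ν :* h) :* u :- c)
                := h :* u :+ i :* (h :* (ν :* u) :- c)) refl ν i h u (b * u) ⟩
  h * u + i * (h * (ν * u) - b * u)
    ≡⟨ cong₂ (λ x y → h * u + i * (h * x - y))
         (fromℕ-*-ratio-cancel (suc n) 1 (suc n ^ m) {{_}} {{m^n≢0 (suc n) m}})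
         (ratio-*-reciprocal (poch (2 +ℕ k) n) (n !) (suc n ^ suc m) {{n !≢0}} {{m^n≢0 (suc n) (suc m)}}) ⟩
  h * u + i * (h * ratio 1 (suc n ^ m) - ratio (poch (2 +ℕ k) n) (n ! *ℕ suc n ^ suc m)) ∎
  where
  open ≡-Reasoning
  A h u i κ ν b : ℚ
  A = hyper (2 +ℕ k) n
  h = hyper (suc k) (suc n)
  u = ratio 1 (suc n ^ suc m)
  i = ratio 1 (suc k)
  κ = fromℕ (suc k)
  ν = fromℕ (suc n)
  b = binom (suc k) n

Spart-suc : ∀ k m N → Spart (2 +ℕ k) (suc m) N
  ≡ Spart (suc k) (suc m) N + ratio 1 (suc k) * (Spart (suc k) m N - Bpart (suc k) (suc m) N)
Spart-suc k m N = begin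
  Spart (2 +ℕ k) (suc m) N                      ≡⟨ sumTo-cong N (hyper-summand-split k m) ⟩
  sumTo N (λ n → S n + i * (S′ n - B (pred n))) ≡⟨ sumTo-+ N S (λ n → i * (S′ n - B (pred n))) ⟩
  sumTo N S + sumTo N (λ n → i * (S′ n - B (pred n)))
    ≡⟨ cong (_+_ (sumTo N S)) (sumTo-*ˡ N i (λ n → S′ n - B (pred n))) ⟩
  sumTo N S + i * sumTo N (λ n → S′ n - B (pred n))
    ≡⟨ cong (λ x → sumTo N S + i * x) (sumTo-- N S′ (λ n → B (pred n))) ⟩
  sumTo N S + i * (sumTo N S′ - sumTo N (λ n → B (pred n)))
    ≡⟨ cong (λ x → sumTo N S + i * (sumTo N S′ - x)) (sumFrom0-sumTo N B) ⟨
  Spart (suc k) (suc m) N + i * (Spart (suc k) m N - Bpart (suc k) (suc m) N) ∎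
  where
  open ≡-Reasoning
  i : ℚ
  i = ratio 1 (suc k)
  S S′ B : ℕ → ℚ
  S n = hyper (suc k) n * ratio 1 (n ^ suc m)
  S′ n = hyper (suc k) n * ratio 1 (n ^ m)
  B n = ratio (poch (2 +ℕ k) n) (n ! *ℕ suc n ^ suc m)

Spart-expansion : ∀ r m N → Spart (suc r) (suc m) N
  ≡ Spart 1 (suc m) N + sumTo r (λ k → ratio 1 k * (Spart k m N - Bpart k (suc m) N))
Spart-expansion zero    m N = sym (+-identityʳ (Spart 1 (suc m) N))
Spart-expansion (suc r) m N = begin
  Spart (2 +ℕ r) (suc m) N                               ≡⟨ Spart-suc r m N ⟩
  Spart (suc r) (suc m) N + t (suc r)                    ≡⟨ cong (_+ t (suc r)) (Spart-expansion r m N) ⟩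
  Spart 1 (suc m) N + sumTo r t + t (suc r)              ≡⟨ +-assoc (Spart 1 (suc m) N) (sumTo r t) (t (suc r)) ⟩
  Spart 1 (suc m) N + sumTo (suc r) t                    ∎
  where
  open ≡-Reasoning
  t : ℕ → ℚ
  t k = ratio 1 k * (Spart k m N - Bpart k (suc m) N)

-- Only r ≥ 1 and m ≥ 1 are used: the stronger hypotheses are needed only for
-- the convergence of the series, not for the identity between partial sums.
theorem4 : (r m : ℕ) → 2 ≤ r → r +ℕ 1 ≤ m →
    (ε : ℚ) → 0ℚ < ε → ∃[ N ] ((n : ℕ) → N ≤ n →
      ∣ Spart r m n - (Spart 1 m n + sumTo (r ∸ 1) (λ k → ratio 1 k * (Spart k (m ∸ 1) n - Bpart k m n))) ∣ < ε)
theorem4 (suc r) (suc m) _ _ ε 0<ε = 0 , λ n _ →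
  subst (λ x → ∣ Spart (suc r) (suc m) n - x ∣ < ε) (Spart-expansion r m n)
    (subst (λ x → ∣ x ∣ < ε) (sym (+-inverseʳ (Spart (suc r) (suc m) n))) 0<ε)
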